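{- For every integer $k\geq 1$, $$\sum_{n\geq 2k}HM_{n,k}x^n=\frac{x^{2k}M^{2k}(x)}{1-x},$$ where $M(x)=\sum_{n\geq 0}m_nx^n$ is the generating function of the Motzkin numbers $m_n$ (the number of Motzkin paths of order $n$). Equivalently, the lower triangular array $(HM_{n,k})$ is the Riordan array $\left(\frac{1}{1-x},\,x^2M^2(x)\right)$.
   Context: A Motzkin path of order $n$ is a lattice path from $(0,0)$ to $(n,0)$ using up steps $(1,1)$, down steps $(1,-1)$ and flat steps $(1,0)$ that never goes below the $x$-axis. A hump is a consecutive sequence of steps of a Motzkin path consisting of an up step, followed by zero or more flat steps, followed by a down step; its height is the $y$-coordinate reached by its up step. $HM_{n,k}$ is the number of pairs $(M,P)$ with $M$ a Motzkin path of order $n$ and $P$ a hump of $M$ of height $k$. A Riordan array $(g(x),f(x))$ is the lower triangular array whose $(n,k)$ entry is $[x^n]\,g(x)f(x)^k$. -}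

module Defs where

open import Data.Nat using (ℕ; zero; suc; _+_; _*_; _∸_; _≤ᵇ_; _≡ᵇ_)
open import Data.Bool using (Bool; true; false; if_then_else_; _∧_)
open import Data.List using (List; []; _∷_; [_]; map; concatMap; filter; upTo; length)
open import Data.Nat.ListAction using (sum)
open import Relation.Nullary.Decidable using (yes; no)
open import Relation.Binary.PropositionalEquality using (_≡_)
open import Data.Bool.Properties using () renaming (_≟_ to _≟B_)

-- U = (1,1), D = (1,-1), F = (1,0)
data Step : Set where
  U D F : Step

words : ℕ → List (List Step)
words zero    = [ [] ]
words (suc n) = concatMap (λ w → (U ∷ w) ∷ (D ∷ w) ∷ (F ∷ w) ∷ []) (words n)

validFrom : ℕ → List Step → Bool
validFrom h       []      = h ≡ᵇ 0
validFrom h       (U ∷ s) = validFrom (suc h) s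
validFrom zero    (D ∷ s) = false
validFrom (suc h) (D ∷ s) = validFrom h s
validFrom h       (F ∷ s) = validFrom h s

isMotzkin : List Step → Bool
isMotzkin = validFrom 0

motzkinPaths : ℕ → List (List Step)
motzkinPaths n = filter (λ w → isMotzkin w ≟B true) (words n)

motzkin : ℕ → ℕ
motzkin n = length (motzkinPaths n)

flatsThenDown : List Step → Bool
flatsThenDown []      = false
flatsThenDown (D ∷ _) = true
flatsThenDown (F ∷ s) = flatsThenDown s
flatsThenDown (U ∷ _) = false

-- Number of humps of height k in the word, read from current height h.
-- A hump is determined by its up step; its height is the y-coordinate
-- reached by that up step.
humpsFrom : ℕ → ℕ → List Step → ℕ
humpsFrom k h []      = 0
humpsFrom k h (U ∷ s) =
  (if flatsThenDown s ∧ (suc h ≡ᵇ k) then 1 else 0) + humpsFrom k (suc h) s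
humpsFrom k h (D ∷ s) = humpsFrom k (h ∸ 1) s
humpsFrom k h (F ∷ s) = humpsFrom k h s

humps : ℕ → List Step → ℕ
humps k = humpsFrom k 0

HM : ℕ → ℕ → ℕ
HM n k = sum (map (humps k) (motzkinPaths n))

Series : Set
Series = ℕ → ℕ

oneS : Series
oneS zero    = 1
oneS (suc _) = 0

_⊛_ : Series → Series → Series
(f ⊛ g) n = sum (map (λ i → f i * g (n ∸ i)) (upTo (suc n)))

_^S_ : Series → ℕ → Series
f ^S zero  = oneS
f ^S suc k = f ⊛ (f ^S k)

shiftS : ℕ → Series → Series
shiftS m f n = if m ≤ᵇ n then f (n ∸ m) else 0

div1-x : Series → Series
div1-x f n = sum (map f (upTo (suc n)))

M : Series
M = motzkin

HMseries : ℕ → Series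
HMseries k n = if (2 * k) ≤ᵇ n then HM n k else 0

-- Let paths h n count the paths of length n from height h down to the axis that
-- never go below it. Splitting off the first step, both these counts and the numbers
-- of pairs (path from height h, hump of height k) satisfy the recurrence
--   f h (n+1) = f (h+1) n + f (h-1) n + f h n,
-- the latter with a source term at h = k-1 that counts the hump tails F^j D.
-- The series x^h M^(h+1) satisfy the same recurrence because M = 1 + x M + x² M²;
-- as that equation is the case h = 0 once paths 1 = x M² is known, both facts are
-- proved together by strong induction on n, so paths h has generating function x^h M^(h+1).
-- The hump counts are then matched with explicit sums of partial sums of these
-- (humpFormula). At height 0 a single term survives: Σ_{i<n} [x^i] x^(2k-1) M^(2k),
-- which is the coefficient of x^n in x^(2k) M^(2k) / (1 - x).

module Submission where

open import Defs
open import Data.Nat using (ℕ; _≤_; _*_)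
open import Relation.Binary.PropositionalEquality using (_≡_)

open import Data.Nat
  using ( zero; suc; pred; _+_; _∸_; _<_; _≤ᵇ_; _≡ᵇ_; _⊓_; ∣_-_∣; s≤s; s≤s⁻¹
        ; compare; less; equal; greater)
open import Data.Nat.Properties
open import Data.Nat.Induction using (<-rec)
open import Algebra.Properties.CommutativeSemigroup +-commutativeSemigroup
  using (interchange; x∙yz≈y∙xz)
open import Data.Bool using (Bool; true; false; if_then_else_; _∧_; T)
open import Data.Bool.Properties using (∧-identityʳ; ∧-zeroʳ; if-eta; if-cong)
  renaming (_≟_ to _≟B_)
open import Data.List using (List; []; _∷_; _∷ʳ_; map; concatMap; filter; upTo; length)
open import Data.List.Properties using (map-cong; map-applyUpTo; map-upTo; map-++; upTo-∷ʳ)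
open import Data.Nat.ListAction using (sum)
open import Data.Nat.ListAction.Properties using (sum-++)
open import Function using (_∘_)
open import Relation.Binary.PropositionalEquality
  using (refl; sym; trans; cong; cong₂; subst; _≢_; module ≡-Reasoning)
open import Relation.Nullary.Decidable using (dec-true; dec-false)
open ≡-Reasoning

sum-map-+ : {A : Set} (f g : A → ℕ) (xs : List A) →
  sum (map (λ x → f x + g x) xs) ≡ sum (map f xs) + sum (map g xs)
sum-map-+ f g []       = refl
sum-map-+ f g (x ∷ xs) =
  trans (cong (f x + g x +_) (sum-map-+ f g xs)) (interchange (f x) (g x) _ _)

sum-map-0 : {A : Set} (xs : List A) → sum (map (λ _ → 0) xs) ≡ 0
sum-map-0 []       = refl
sum-map-0 (x ∷ xs) = sum-map-0 xs

length≡sum-map-1 : {A : Set} (xs : List A) → length xs ≡ sum (map (λ _ → 1) xs)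
length≡sum-map-1 []       = refl
length≡sum-map-1 (x ∷ xs) = cong suc (length≡sum-map-1 xs)

sum-filter : {A : Set} (p : A → Bool) (g : A → ℕ) (xs : List A) →
  sum (map g (filter (λ x → p x ≟B true) xs)) ≡ sum (map (λ x → if p x then g x else 0) xs)
sum-filter p g []       = refl
sum-filter p g (x ∷ xs) with p x
... | true  = cong (g x +_) (sum-filter p g xs)
... | false = sum-filter p g xs

prefixSum : (ℕ → ℕ) → ℕ → ℕ
prefixSum f n = sum (map f (upTo n))

prefixSum-suc : ∀ f n → prefixSum f (suc n) ≡ prefixSum f n + f n
prefixSum-suc f n = begin
  sum (map f (upTo (suc n)))          ≡⟨ cong (sum ∘ map f) (upTo-∷ʳ n) ⟨
  sum (map f (upTo n ∷ʳ n))           ≡⟨ cong sum (map-++ f (upTo n) _) ⟩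
  sum (map f (upTo n) ∷ʳ f n)         ≡⟨ sum-++ (map f (upTo n)) _ ⟩
  prefixSum f n + (f n + 0)           ≡⟨ cong (prefixSum f n +_) (+-identityʳ (f n)) ⟩
  prefixSum f n + f n                 ∎

prefixSum-sucˡ : ∀ f n → prefixSum f (suc n) ≡ f 0 + prefixSum (f ∘ suc) n
prefixSum-sucˡ f n =
  cong (λ xs → f 0 + sum xs) (trans (map-applyUpTo suc f n) (sym (map-upTo (f ∘ suc) n)))

prefixSum-cong : ∀ {f g} → (∀ i → f i ≡ g i) → ∀ n → prefixSum f n ≡ prefixSum g n
prefixSum-cong f≗g n = cong sum (map-cong f≗g (upTo n))

prefixSum-+ : ∀ f g n → prefixSum (λ i → f i + g i) n ≡ prefixSum f n + prefixSum g n
prefixSum-+ f g n = sum-map-+ f g (upTo n)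

-- Power series

infixl 6 _⊕_
_⊕_ : Series → Series → Series
(f ⊕ g) n = f n + g n

shift : ℕ → Series → Series
shift zero    f n       = f n
shift (suc m) f zero    = 0
shift (suc m) f (suc n) = shift m f n

infix 4 _≐[_]_
_≐[_]_ : Series → ℕ → Series → Set
f ≐[ n ] g = ∀ {q} → q ≤ n → f q ≡ g q

shiftS≡shift : ∀ m f n → shiftS m f n ≡ shift m f n
shiftS≡shift zero          f n       = refl
shiftS≡shift (suc m)       f zero    = refl
shiftS≡shift (suc zero)    f (suc n) = refl
shiftS≡shift (suc (suc m)) f (suc n) = shiftS≡shift (suc m) f n

shift-below : ∀ m f {n} → n < m → shift m f n ≡ 0
shift-below (suc m) f {zero}  _       = refl
shift-below (suc m) f {suc n} 1+n<1+m = shift-below m f (s≤s⁻¹ 1+n<1+m)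

shift-shift : ∀ m f n → shift m (shift 1 f) n ≡ shift (suc m) f n
shift-shift zero    f zero    = refl
shift-shift zero    f (suc n) = refl
shift-shift (suc m) f zero    = refl
shift-shift (suc m) f (suc n) = shift-shift m f n

shift-⊕ : ∀ m f g n → shift m (f ⊕ g) n ≡ shift m f n + shift m g n
shift-⊕ zero    f g n       = refl
shift-⊕ (suc m) f g zero    = refl
shift-⊕ (suc m) f g (suc n) = shift-⊕ m f g n

shift-cong : ∀ m {f g n} → f ≐[ n ] g → shift m f n ≡ shift m g n
shift-cong zero    {n = n}     f≐g = f≐g ≤-refl
shift-cong (suc m) {n = zero}  f≐g = refl
shift-cong (suc m) {n = suc n} f≐g = shift-cong m (f≐g ∘ m≤n⇒m≤1+n)

⊛-unfold : ∀ f g n → (f ⊛ g) n ≡ f 0 * g n + shift 1 ((f ∘ suc) ⊛ g) n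
⊛-unfold f g zero    = refl
⊛-unfold f g (suc n) = prefixSum-sucˡ (λ i → f i * g (suc n ∸ i)) (suc n)

⊛-identityʳ : ∀ f n → (f ⊛ oneS) n ≡ f n
⊛-identityʳ f zero    = trans (+-identityʳ (f 0 * 1)) (*-identityʳ (f 0))
⊛-identityʳ f (suc n) = begin
  (f ⊛ oneS) (suc n)                      ≡⟨ ⊛-unfold f oneS (suc n) ⟩
  f 0 * 0 + ((f ∘ suc) ⊛ oneS) n          ≡⟨ cong₂ _+_ (*-zeroʳ (f 0)) (⊛-identityʳ (f ∘ suc) n) ⟩
  f (suc n)                               ∎

⊛-congʳ : ∀ f {g g' n} → g ≐[ n ] g' → (f ⊛ g) n ≡ (f ⊛ g') n
⊛-congʳ f {n = n} g≐g' =
  cong sum (map-cong (λ i → cong (f i *_) (g≐g' (m∸n≤m n i))) (upTo (suc n)))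

⊛-distribˡ-⊕ : ∀ f g h n → (f ⊛ (g ⊕ h)) n ≡ (f ⊛ g) n + (f ⊛ h) n
⊛-distribˡ-⊕ f g h n = trans
  (prefixSum-cong (λ i → *-distribˡ-+ (f i) (g (n ∸ i)) (h (n ∸ i))) (suc n))
  (prefixSum-+ (λ i → f i * g (n ∸ i)) (λ i → f i * h (n ∸ i)) (suc n))

⊛-shiftʳ : ∀ f g n → (f ⊛ shift 1 g) n ≡ shift 1 (f ⊛ g) n
⊛-shiftʳ f g zero    = trans (+-identityʳ (f 0 * 0)) (*-zeroʳ (f 0))
⊛-shiftʳ f g (suc n) = begin
  (f ⊛ shift 1 g) (suc n)                  ≡⟨ ⊛-unfold f (shift 1 g) (suc n) ⟩
  f 0 * g n + ((f ∘ suc) ⊛ shift 1 g) n    ≡⟨ cong (f 0 * g n +_) (⊛-shiftʳ (f ∘ suc) g n) ⟩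
  f 0 * g n + shift 1 ((f ∘ suc) ⊛ g) n    ≡⟨ ⊛-unfold f g n ⟨
  (f ⊛ g) n                                ∎

MotzkinEquation : ℕ → ℕ → Set
MotzkinEquation n j =
  M ^S suc j ≐[ n ] (M ^S j ⊕ shift 1 (M ^S suc j ⊕ shift 1 (M ^S suc (suc j))))

motzkinEquation-suc : ∀ n j → MotzkinEquation n j → MotzkinEquation n (suc j)
motzkinEquation-suc n j eq {q} q≤n = begin
  (M ⊛ P₁) q
    ≡⟨ ⊛-congʳ M (λ i≤q → eq (≤-trans i≤q q≤n)) ⟩
  (M ⊛ (P₀ ⊕ shift 1 (P₁ ⊕ shift 1 P₂))) q
    ≡⟨ ⊛-distribˡ-⊕ M P₀ (shift 1 (P₁ ⊕ shift 1 P₂)) q ⟩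
  (M ⊛ P₀) q + (M ⊛ shift 1 (P₁ ⊕ shift 1 P₂)) q
    ≡⟨ cong ((M ⊛ P₀) q +_) (⊛-shiftʳ M (P₁ ⊕ shift 1 P₂) q) ⟩
  (M ⊛ P₀) q + shift 1 (M ⊛ (P₁ ⊕ shift 1 P₂)) q
    ≡⟨ cong ((M ⊛ P₀) q +_) (distribute q) ⟩
  (M ⊛ P₀) q + shift 1 ((M ⊛ P₁) ⊕ shift 1 (M ⊛ P₂)) q ∎
  where
  P₀ P₁ P₂ : Series
  P₀ = M ^S j
  P₁ = M ^S suc j
  P₂ = M ^S suc (suc j)
  distribute : ∀ q → shift 1 (M ⊛ (P₁ ⊕ shift 1 P₂)) q ≡ shift 1 ((M ⊛ P₁) ⊕ shift 1 (M ⊛ P₂)) q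
  distribute zero    = refl
  distribute (suc q) =
    trans (⊛-distribˡ-⊕ M P₁ (shift 1 P₂) q) (cong ((M ⊛ P₁) q +_) (⊛-shiftʳ M P₂ q))

-- Sums over paths

Σwords : ℕ → (List Step → ℕ) → ℕ
Σwords n φ = sum (map φ (words n))

Σwords-suc : ∀ n φ →
  Σwords (suc n) φ ≡ Σwords n (φ ∘ (U ∷_)) + (Σwords n (φ ∘ (D ∷_)) + Σwords n (φ ∘ (F ∷_)))
Σwords-suc n φ = begin
  Σwords (suc n) φ
    ≡⟨ byFirstStep (words n) ⟩
  sum (map (λ w → φ (U ∷ w) + (φ (D ∷ w) + φ (F ∷ w))) (words n))
    ≡⟨ sum-map-+ (φ ∘ (U ∷_)) _ (words n) ⟩
  Σwords n (φ ∘ (U ∷_)) + sum (map (λ w → φ (D ∷ w) + φ (F ∷ w)) (words n))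
    ≡⟨ cong (Σwords n (φ ∘ (U ∷_)) +_) (sum-map-+ (φ ∘ (D ∷_)) (φ ∘ (F ∷_)) (words n)) ⟩
  Σwords n (φ ∘ (U ∷_)) + (Σwords n (φ ∘ (D ∷_)) + Σwords n (φ ∘ (F ∷_)))
    ∎
  where
  regroup : ∀ a b c s → a + (b + (c + s)) ≡ (a + (b + c)) + s
  regroup a b c s = sym (trans (+-assoc a (b + c) s) (cong (a +_) (+-assoc b c s)))
  byFirstStep : ∀ ws → sum (map φ (concatMap (λ w → (U ∷ w) ∷ (D ∷ w) ∷ (F ∷ w) ∷ []) ws))
                     ≡ sum (map (λ w → φ (U ∷ w) + (φ (D ∷ w) + φ (F ∷ w))) ws)
  byFirstStep []       = refl
  byFirstStep (w ∷ ws) =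
    trans (cong (λ s → φ (U ∷ w) + (φ (D ∷ w) + (φ (F ∷ w) + s))) (byFirstStep ws))
          (regroup (φ (U ∷ w)) (φ (D ∷ w)) (φ (F ∷ w)) _)

pathSum : ℕ → ℕ → (List Step → ℕ) → ℕ
pathSum h n g = Σwords n (λ w → if validFrom h w then g w else 0)

downSum : ℕ → ℕ → (List Step → ℕ) → ℕ
downSum zero    n g = 0
downSum (suc h) n g = pathSum h n (g ∘ (D ∷_))

pathSum-suc : ∀ h n g → pathSum h (suc n) g ≡
  pathSum (suc h) n (g ∘ (U ∷_)) + (downSum h n g + pathSum h n (g ∘ (F ∷_)))
pathSum-suc zero    n g = trans (Σwords-suc n _)
  (cong (λ s → pathSum 1 n (g ∘ (U ∷_)) + (s + pathSum 0 n (g ∘ (F ∷_)))) (sum-map-0 (words n)))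
pathSum-suc (suc h) n g = Σwords-suc n _

pathSum-cong : ∀ h n {f g} → (∀ w → f w ≡ g w) → pathSum h n f ≡ pathSum h n g
pathSum-cong h n f≗g = cong sum (map-cong (λ w → cong (if validFrom h w then_else 0) (f≗g w)) (words n))

pathSum-+ : ∀ h n f g → pathSum h n (λ w → f w + g w) ≡ pathSum h n f + pathSum h n g
pathSum-+ h n f g =
  trans (cong sum (map-cong (λ w → if-+ (validFrom h w)) (words n))) (sum-map-+ _ _ (words n))
  where
  if-+ : ∀ b {x y} → (if b then x + y else 0) ≡ (if b then x else 0) + (if b then y else 0)
  if-+ true  = refl
  if-+ false = refl

pathSum-0 : ∀ h n → pathSum h n (λ _ → 0) ≡ 0
pathSum-0 h n = trans (cong sum (map-cong (λ w → if-eta (validFrom h w)) (words n))) (sum-map-0 (words n))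

pathSum-[] : ∀ h g → g [] ≡ 0 → pathSum h 0 g ≡ 0
pathSum-[] h g g[]≡0 =
  trans (+-identityʳ _) (trans (cong (if validFrom h [] then_else 0) g[]≡0) (if-eta _))

-- Paths from height h

below : (ℕ → ℕ → ℕ) → ℕ → ℕ → ℕ
below f zero    n = 0
below f (suc h) n = f h n

MotzkinRecurrenceAt : (source f : ℕ → ℕ → ℕ) → ℕ → ℕ → Set
MotzkinRecurrenceAt source f h n = f h (suc n) ≡ source h n + (f (suc h) n + (below f h n + f h n))

MotzkinRecurrence : (source f : ℕ → ℕ → ℕ) → Set
MotzkinRecurrence source f = ∀ h n → MotzkinRecurrenceAt source f h n

motzkinRecurrence-unique : ∀ {source f g} →
  MotzkinRecurrence source f → MotzkinRecurrence source g → (∀ h → f h 0 ≡ g h 0) →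
  ∀ n h → f h n ≡ g h n
motzkinRecurrence-unique                 rec-f rec-g f≡g₀ zero    h = f≡g₀ h
motzkinRecurrence-unique {source} {f} {g} rec-f rec-g f≡g₀ (suc n) h = begin
  f h (suc n)
    ≡⟨ rec-f h n ⟩
  source h n + (f (suc h) n + (below f h n + f h n))
    ≡⟨ cong (source h n +_) (cong₂ _+_ (ih (suc h)) (cong₂ _+_ (below-ih h) (ih h))) ⟩
  source h n + (g (suc h) n + (below g h n + g h n))
    ≡⟨ rec-g h n ⟨
  g h (suc n) ∎
  where
  ih : ∀ h → f h n ≡ g h n
  ih = motzkinRecurrence-unique {source} {f} {g} rec-f rec-g f≡g₀ n
  below-ih : ∀ h → below f h n ≡ below g h n
  below-ih zero    = refl
  below-ih (suc h) = ih h

paths : ℕ → ℕ → ℕ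
paths h n = pathSum h n (λ _ → 1)

paths-rec : MotzkinRecurrence (λ _ _ → 0) paths
paths-rec zero    n = pathSum-suc zero n _
paths-rec (suc h) n = pathSum-suc (suc h) n _

motzkin≡paths : ∀ n → motzkin n ≡ paths 0 n
motzkin≡paths n = trans (length≡sum-map-1 (motzkinPaths n)) (sum-filter isMotzkin _ (words n))

pathsSeries : ℕ → Series
pathsSeries h = shift h (M ^S suc h)

paths≡pathsSeries-0 : ∀ n → paths 0 n ≡ pathsSeries 0 n
paths≡pathsSeries-0 n = trans (sym (motzkin≡paths n)) (sym (⊛-identityʳ M n))

motzkinEquation-0 : ∀ n → (∀ {m} → m < n → paths 1 m ≡ pathsSeries 1 m) → MotzkinEquation n 0
motzkinEquation-0 n ih {zero}  _   = refl
motzkinEquation-0 n ih {suc q} q<n = begin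
  (M ⊛ oneS) (suc q)                          ≡⟨ ⊛-identityʳ M (suc q) ⟩
  motzkin (suc q)                             ≡⟨ motzkin≡paths (suc q) ⟩
  paths 0 (suc q)                             ≡⟨ paths-rec 0 q ⟩
  paths 1 q + paths 0 q                       ≡⟨ cong₂ _+_ (ih q<n) (paths≡pathsSeries-0 q) ⟩
  pathsSeries 1 q + pathsSeries 0 q           ≡⟨ +-comm (pathsSeries 1 q) _ ⟩
  (M ⊛ oneS) q + shift 1 (M ^S 2) q           ∎

pathsSeries-rec : ∀ n h → MotzkinEquation n (suc h) →
  pathsSeries (suc h) (suc n) ≡ pathsSeries (suc (suc h)) n + (pathsSeries h n + pathsSeries (suc h) n)
pathsSeries-rec n h eq = begin
  pathsSeries (suc h) (suc n)
    ≡⟨⟩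
  shift h P₁ n
    ≡⟨ shift-cong h eq ⟩
  shift h (P₀ ⊕ shift 1 (P₁ ⊕ shift 1 P₂)) n
    ≡⟨ shift-⊕ h P₀ _ n ⟩
  shift h P₀ n + shift h (shift 1 (P₁ ⊕ shift 1 P₂)) n
    ≡⟨ cong (shift h P₀ n +_) (shift-shift h _ n) ⟩
  shift h P₀ n + shift (suc h) (P₁ ⊕ shift 1 P₂) n
    ≡⟨ cong (shift h P₀ n +_) (shift-⊕ (suc h) P₁ _ n) ⟩
  shift h P₀ n + (shift (suc h) P₁ n + shift (suc h) (shift 1 P₂) n)
    ≡⟨ cong (λ s → shift h P₀ n + (shift (suc h) P₁ n + s)) (shift-shift (suc h) P₂ n) ⟩
  shift h P₀ n + (shift (suc h) P₁ n + shift (suc (suc h)) P₂ n)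
    ≡⟨ +-assoc (shift h P₀ n) _ _ ⟨
  shift h P₀ n + shift (suc h) P₁ n + shift (suc (suc h)) P₂ n
    ≡⟨ +-comm _ (shift (suc (suc h)) P₂ n) ⟩
  shift (suc (suc h)) P₂ n + (shift h P₀ n + shift (suc h) P₁ n) ∎
  where
  P₀ P₁ P₂ : Series
  P₀ = M ^S suc h
  P₁ = M ^S suc (suc h)
  P₂ = M ^S suc (suc (suc h))

paths≡pathsSeries : ∀ n h → paths h n ≡ pathsSeries h n
paths≡pathsSeries = <-rec _ step
  where
  step : ∀ n → (∀ {m} → m < n → ∀ h → paths h m ≡ pathsSeries h m) →
         ∀ h → paths h n ≡ pathsSeries h n
  step n       ih zero    = paths≡pathsSeries-0 n
  step zero    ih (suc h) = refl
  step (suc n) ih (suc h) = begin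
    paths (suc h) (suc n)
      ≡⟨ paths-rec (suc h) n ⟩
    paths (suc (suc h)) n + (paths h n + paths (suc h) n)
      ≡⟨ cong₂ _+_ (ih′ (suc (suc h))) (cong₂ _+_ (ih′ h) (ih′ (suc h))) ⟩
    pathsSeries (suc (suc h)) n + (pathsSeries h n + pathsSeries (suc h) n)
      ≡⟨ pathsSeries-rec n h (equation (suc h)) ⟨
    pathsSeries (suc h) (suc n) ∎
    where
    ih′ : ∀ h → paths h n ≡ pathsSeries h n
    ih′ = ih ≤-refl
    equation : ∀ j → MotzkinEquation n j
    equation zero    = motzkinEquation-0 n (λ m<n → ih (m<n⇒m<1+n m<n) 1)
    equation (suc j) = motzkinEquation-suc n j (equation j)

paths-below : ∀ {h n} → n < h → paths h n ≡ 0
paths-below {h} {n} n<h = trans (paths≡pathsSeries n h) (shift-below h _ n<h)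

cumPaths : ℕ → ℕ → ℕ
cumPaths h = prefixSum (paths h)

cumPaths-rec : ∀ m n →
  cumPaths (suc m) (suc n) ≡ cumPaths (suc (suc m)) n + (cumPaths m n + cumPaths (suc m) n)
cumPaths-rec m n = begin
  cumPaths (suc m) (suc n)
    ≡⟨ prefixSum-sucˡ (paths (suc m)) n ⟩
  prefixSum (λ i → paths (suc m) (suc i)) n
    ≡⟨ prefixSum-cong (paths-rec (suc m)) n ⟩
  prefixSum (λ i → paths (suc (suc m)) i + (paths m i + paths (suc m) i)) n
    ≡⟨ prefixSum-+ (paths (suc (suc m))) _ n ⟩
  cumPaths (suc (suc m)) n + prefixSum (λ i → paths m i + paths (suc m) i) n
    ≡⟨ cong (cumPaths (suc (suc m)) n +_) (prefixSum-+ (paths m) (paths (suc m)) n) ⟩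
  cumPaths (suc (suc m)) n + (cumPaths m n + cumPaths (suc m) n) ∎

cumPaths-below : ∀ {m n} → n ≤ m → cumPaths m n ≡ 0
cumPaths-below {m} {zero}  _     = refl
cumPaths-below {m} {suc n} n<m = begin
  cumPaths m (suc n)        ≡⟨ prefixSum-suc (paths m) n ⟩
  cumPaths m n + paths m n  ≡⟨ cong₂ _+_ (cumPaths-below (<⇒≤ n<m)) (paths-below n<m) ⟩
  0                         ∎

-- Humps

flatsThenDownPaths : ℕ → ℕ → ℕ
flatsThenDownPaths h n = pathSum h n (λ w → if flatsThenDown w then 1 else 0)

flatsThenDownPaths≡cumPaths : ∀ h n → flatsThenDownPaths (suc h) n ≡ cumPaths h n
flatsThenDownPaths≡cumPaths h zero    = refl
flatsThenDownPaths≡cumPaths h (suc n) = begin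
  flatsThenDownPaths (suc h) (suc n)
    ≡⟨ pathSum-suc (suc h) n _ ⟩
  pathSum (suc (suc h)) n (λ _ → 0) + (paths h n + flatsThenDownPaths (suc h) n)
    ≡⟨ cong (_+ (paths h n + flatsThenDownPaths (suc h) n)) (pathSum-0 (suc (suc h)) n) ⟩
  paths h n + flatsThenDownPaths (suc h) n
    ≡⟨ +-comm (paths h n) _ ⟩
  flatsThenDownPaths (suc h) n + paths h n
    ≡⟨ cong (_+ paths h n) (flatsThenDownPaths≡cumPaths h n) ⟩
  cumPaths h n + paths h n
    ≡⟨ prefixSum-suc (paths h) n ⟨
  cumPaths h (suc n) ∎

humpCount : ℕ → ℕ → ℕ → ℕ
humpCount k h n = pathSum h n (humpsFrom k h)

humpSource : ℕ → ℕ → ℕ → ℕ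
humpSource k h n = if suc h ≡ᵇ k then cumPaths h n else 0

humpCount-rec : ∀ k → MotzkinRecurrence (humpSource k) (humpCount k)
humpCount-rec k h n = begin
  humpCount k h (suc n)
    ≡⟨ pathSum-suc h n (humpsFrom k h) ⟩
  pathSum (suc h) n (λ w → hump w + humpsFrom k (suc h) w) + (downSum h n (humpsFrom k h) + humpCount k h n)
    ≡⟨ cong₂ (λ u d → u + (d + humpCount k h n)) up (down h) ⟩
  (humpSource k h n + humpCount k (suc h) n) + (below (humpCount k) h n + humpCount k h n)
    ≡⟨ +-assoc (humpSource k h n) _ _ ⟩
  humpSource k h n + (humpCount k (suc h) n + (below (humpCount k) h n + humpCount k h n)) ∎
  where
  hump : List Step → ℕ
  hump w = if flatsThenDown w ∧ (suc h ≡ᵇ k) then 1 else 0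
  source : pathSum (suc h) n hump ≡ humpSource k h n
  source with suc h ≡ᵇ k
  ... | true  = trans (pathSum-cong (suc h) n (λ w → if-cong (∧-identityʳ (flatsThenDown w))))
                      (flatsThenDownPaths≡cumPaths h n)
  ... | false = trans (pathSum-cong (suc h) n (λ w → if-cong (∧-zeroʳ (flatsThenDown w))))
                      (pathSum-0 (suc h) n)
  up : pathSum (suc h) n (λ w → hump w + humpsFrom k (suc h) w) ≡ humpSource k h n + humpCount k (suc h) n
  up = trans (pathSum-+ (suc h) n hump (humpsFrom k (suc h))) (cong (_+ humpCount k (suc h) n) source)
  down : ∀ h → downSum h n (humpsFrom k h) ≡ below (humpCount k) h n
  down zero    = refl
  down (suc h) = refl

humpCount-0 : ∀ k h → humpCount k h 0 ≡ 0
humpCount-0 k h = pathSum-[] h (humpsFrom k h) refl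

window : ℕ → ℕ → ℕ → ℕ
window a zero    n = 0
window a (suc c) n = cumPaths a n + window (suc (suc a)) c n

window-0 : ∀ a c → window a c 0 ≡ 0
window-0 a zero    = refl
window-0 a (suc c) = window-0 (suc (suc a)) c

window-rec : ∀ a c n →
  window (suc a) c (suc n) ≡ window (suc (suc a)) c n + (window a c n + window (suc a) c n)
window-rec a zero    n = refl
window-rec a (suc c) n = begin
  cumPaths (suc a) (suc n) + window (suc (suc (suc a))) c (suc n)
    ≡⟨ cong₂ _+_ (cumPaths-rec a n) (window-rec (suc (suc a)) c n) ⟩
  (x₂ + (x₀ + x₁)) + (w₂ + (w₀ + w₁))
    ≡⟨ interchange x₂ (x₀ + x₁) w₂ (w₀ + w₁) ⟩
  (x₂ + w₂) + ((x₀ + x₁) + (w₀ + w₁))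
    ≡⟨ cong ((x₂ + w₂) +_) (interchange x₀ x₁ w₀ w₁) ⟩
  (x₂ + w₂) + ((x₀ + w₀) + (x₁ + w₁))
    ∎
  where
  x₀ x₁ x₂ w₀ w₁ w₂ : ℕ
  x₀ = cumPaths a n
  x₁ = cumPaths (suc a) n
  x₂ = cumPaths (suc (suc a)) n
  w₀ = window (suc (suc a)) c n
  w₁ = window (suc (suc (suc a))) c n
  w₂ = window (suc (suc (suc (suc a)))) c n

-- Paths from height h to height K have generating function
-- Σ_{j ≤ min(h,K)} x^(|h-K|+2j) M^(|h-K|+2j+1); followed by a hump and by a path
-- from K down to 0, the j-th summand contributes cumPaths (|h-K| + 2j + K + 1).
humpFormula : ℕ → ℕ → ℕ → ℕ
humpFormula K h n = window (suc (∣ h - K ∣ + K)) (suc (h ⊓ K)) n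

humpFormula-≥ : ∀ {K h} n → K ≤ h → humpFormula K h n ≡ window (suc h) (suc K) n
humpFormula-≥ n K≤h = cong₂ (λ a c → window (suc a) (suc c) n)
  (trans (cong (_+ _) (m≤n⇒∣n-m∣≡n∸m K≤h)) (m∸n+n≡m K≤h)) (m≥n⇒m⊓n≡n K≤h)

humpFormula-≤ : ∀ {K h} d n → K ≡ h + d → humpFormula K h n ≡ window (suc (d + K)) (suc h) n
humpFormula-≤ {h = h} d n refl = cong₂ (λ a c → window (suc (a + (h + d))) (suc c) n)
  (∣m-m+n∣≡n h d) (m≤n⇒m⊓n≡m (m≤m+n h d))

humpFormula-below : ∀ {K} h d n → K ≡ h + d →
  below (humpFormula K) h n ≡ window (suc (suc (d + K))) h n
humpFormula-below zero    d n _  = refl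
humpFormula-below (suc h) d n eq = humpFormula-≤ (suc d) n (trans eq (sym (+-suc h d)))

humpSource-≡ : ∀ K n → humpSource (suc K) K n ≡ cumPaths K n
humpSource-≡ K n = if-cong (dec-true (K ≟ K) refl)

humpSource-≢ : ∀ {K h} n → h ≢ K → humpSource (suc K) h n ≡ 0
humpSource-≢ {K} {h} n h≢K = if-cong (dec-false (h ≟ K) h≢K)

humpFormula-rec-< : ∀ h d n →
  MotzkinRecurrenceAt (humpSource (suc (suc (h + d)))) (humpFormula (suc (h + d))) h n
humpFormula-rec-< h d n = begin
  humpFormula K h (suc n)
    ≡⟨ humpFormula-≤ (suc d) (suc n) K≡h+1+d ⟩
  window (suc a) (suc h) (suc n)
    ≡⟨ window-rec a (suc h) n ⟩
  (x₂ + w₄) + ((x₀ + w₂) + w₁)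
    ≡⟨ cong ((x₂ + w₄) +_) (+-assoc x₀ w₂ w₁) ⟩
  (x₂ + w₄) + (x₀ + (w₂ + w₁))
    ≡⟨ x∙yz≈y∙xz (x₂ + w₄) x₀ (w₂ + w₁) ⟩
  x₀ + ((x₂ + w₄) + (w₂ + w₁))
    ≡⟨ +-assoc x₀ (x₂ + w₄) (w₂ + w₁) ⟨
  (x₀ + (x₂ + w₄)) + (w₂ + w₁)
    ≡⟨ cong₂ _+_ (humpFormula-≤ d n refl)
                 (cong₂ _+_ (humpFormula-below h (suc d) n K≡h+1+d) (humpFormula-≤ (suc d) n K≡h+1+d)) ⟨
  humpFormula K (suc h) n + (below (humpFormula K) h n + humpFormula K h n)
    ≡⟨ cong₂ _+_ (humpSource-≢ n (<⇒≢ (s≤s (m≤m+n h d)))) refl ⟨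
  humpSource (suc K) h n + (humpFormula K (suc h) n + (below (humpFormula K) h n + humpFormula K h n)) ∎
  where
  K a x₀ x₂ w₁ w₂ w₄ : ℕ
  K  = suc (h + d)
  a  = suc (d + K)
  x₀ = cumPaths a n
  x₂ = cumPaths (suc (suc a)) n
  w₁ = window (suc a) (suc h) n
  w₂ = window (suc (suc a)) h n
  w₄ = window (suc (suc (suc (suc a)))) h n
  K≡h+1+d : K ≡ h + suc d
  K≡h+1+d = sym (+-suc h d)

humpFormula-rec-≡ : ∀ K n → MotzkinRecurrenceAt (humpSource (suc K)) (humpFormula K) K n
humpFormula-rec-≡ K n = begin
  humpFormula K K (suc n)
    ≡⟨ humpFormula-≥ (suc n) ≤-refl ⟩
  window (suc K) (suc K) (suc n)
    ≡⟨ window-rec K (suc K) n ⟩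
  w₊ + ((cumPaths K n + w₋) + w)
    ≡⟨ cong (w₊ +_) (+-assoc (cumPaths K n) w₋ w) ⟩
  w₊ + (cumPaths K n + (w₋ + w))
    ≡⟨ x∙yz≈y∙xz w₊ (cumPaths K n) (w₋ + w) ⟩
  cumPaths K n + (w₊ + (w₋ + w))
    ≡⟨ cong₂ _+_ (humpSource-≡ K n)
                 (cong₂ _+_ (humpFormula-≥ n (n≤1+n K))
                            (cong₂ _+_ (humpFormula-below K 0 n (sym (+-identityʳ K))) (humpFormula-≥ n ≤-refl))) ⟨
  humpSource (suc K) K n + (humpFormula K (suc K) n + (below (humpFormula K) K n + humpFormula K K n)) ∎
  where
  w w₊ w₋ : ℕ
  w  = window (suc K) (suc K) n
  w₊ = window (suc (suc K)) (suc K) n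
  w₋ = window (suc (suc K)) K n

humpFormula-rec-> : ∀ K e n → MotzkinRecurrenceAt (humpSource (suc K)) (humpFormula K) (suc (K + e)) n
humpFormula-rec-> K e n = begin
  humpFormula K h (suc n)
    ≡⟨ humpFormula-≥ (suc n) K≤h ⟩
  window (suc h) (suc K) (suc n)
    ≡⟨ window-rec h (suc K) n ⟩
  window (suc (suc h)) (suc K) n + (window h (suc K) n + window (suc h) (suc K) n)
    ≡⟨ cong₂ _+_ (humpFormula-≥ n (m≤n⇒m≤1+n K≤h))
                 (cong₂ _+_ (humpFormula-≥ n (m≤m+n K e)) (humpFormula-≥ n K≤h)) ⟨
  humpFormula K (suc h) n + (below (humpFormula K) h n + humpFormula K h n)
    ≡⟨ cong₂ _+_ (humpSource-≢ n (>⇒≢ K<h)) refl ⟨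
  humpSource (suc K) h n + (humpFormula K (suc h) n + (below (humpFormula K) h n + humpFormula K h n)) ∎
  where
  h : ℕ
  h   = suc (K + e)
  K<h : K < h
  K<h = s≤s (m≤m+n K e)
  K≤h : K ≤ h
  K≤h = <⇒≤ K<h

humpFormula-rec : ∀ K → MotzkinRecurrence (humpSource (suc K)) (humpFormula K)
humpFormula-rec K h n with compare h K
... | less    h d = humpFormula-rec-< h d n
... | equal   K   = humpFormula-rec-≡ K n
... | greater K e = humpFormula-rec-> K e n

humpCount≡humpFormula : ∀ K n h → humpCount (suc K) h n ≡ humpFormula K h n
humpCount≡humpFormula K =
  motzkinRecurrence-unique {humpSource (suc K)} (humpCount-rec (suc K)) (humpFormula-rec K)
  (λ h → trans (humpCount-0 (suc K) h) (sym (window-0 (suc (∣ h - K ∣ + K)) (suc (h ⊓ K)))))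

HM≡cumPaths : ∀ K n → HM n (suc K) ≡ cumPaths (pred (2 * suc K)) n
HM≡cumPaths K n = begin
  HM n (suc K)
    ≡⟨ sum-filter isMotzkin (humps (suc K)) (words n) ⟩
  humpCount (suc K) 0 n
    ≡⟨ humpCount≡humpFormula K n 0 ⟩
  cumPaths (suc (K + K)) n + 0
    ≡⟨ +-identityʳ _ ⟩
  cumPaths (suc (K + K)) n
    ≡⟨ cong (λ m → cumPaths m n) (trans (sym (+-suc K K)) (cong (λ i → K + suc i) (sym (+-identityʳ K)))) ⟩
  cumPaths (pred (2 * suc K)) n ∎

HMseries≡cumPaths : ∀ K n → HMseries (suc K) n ≡ cumPaths (pred (2 * suc K)) n
HMseries≡cumPaths K n with 2 * suc K ≤ᵇ n in 2k≤ᵇn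
... | true  = HM≡cumPaths K n
... | false =
  sym (cumPaths-below {pred (2 * suc K)} {n} (s≤s⁻¹ (≰⇒> λ 2k≤n → subst T 2k≤ᵇn (≤⇒≤ᵇ 2k≤n))))

div1-x≡cumPaths : ∀ m n → div1-x (shiftS (suc m) (M ^S suc m)) n ≡ cumPaths m n
div1-x≡cumPaths m n = begin
  prefixSum (shiftS (suc m) (M ^S suc m)) (suc n)
    ≡⟨ prefixSum-sucˡ (shiftS (suc m) (M ^S suc m)) n ⟩
  prefixSum (λ i → shiftS (suc m) (M ^S suc m) (suc i)) n
    ≡⟨ prefixSum-cong coefficient n ⟩
  cumPaths m n ∎
  where
  coefficient : ∀ i → shiftS (suc m) (M ^S suc m) (suc i) ≡ paths m i
  coefficient i = trans (shiftS≡shift (suc m) _ (suc i)) (sym (paths≡pathsSeries i m))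

corollary2p3 : (k : ℕ) → 1 ≤ k → (n : ℕ) →
    HMseries k n ≡ div1-x (shiftS (2 * k) (M ^S (2 * k))) n
corollary2p3 (suc K) _ n =
  trans (HMseries≡cumPaths K n) (sym (div1-x≡cumPaths (pred (2 * suc K)) n))
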